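{- Let $i\ge j\ge 1$, $k\ge 1$, $l\ge 1$ be integers with $i+j+k+l=n-3$. Then $F(R_{i+1,j-1,k,l}) > F(R_{i,j,k,l})$. In particular, $F(R_{i+j,0,k,l}) > F(R_{i,j,k,l})$.
   Context: All graphs are finite and simple. The F-index of a graph $G$ is $F(G)=\sum_{v\in V(G)} d_G(v)^3$. For integers $i,j\ge 0$ and $k,l\ge 1$, $R_{i,j,k,l}$ is the graph obtained from a triangle $xyz$ by attaching $i$ new leaves to $x$, $j$ new leaves to $y$ and $k$ new pendant vertices to $z$, and then attaching $l$ new leaves to one of the $k$ pendant vertices adjacent to $z$ (here attaching a leaf to a vertex means adding a new vertex adjacent only to it). It has $i+j+k+l+3$ vertices. -}

module Defs where

open import Data.Nat using (ℕ; zero; suc; _+_; _^_; _≡ᵇ_)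
open import Data.Bool using (Bool; true; false; _∨_; if_then_else_)
open import Data.Bool.Properties using (∨-comm)
open import Data.Fin using (Fin; toℕ; splitAt)
open import Data.Sum using (inj₁; inj₂)
open import Data.List using (List; map; filter; length)
open import Data.Nat.ListAction using (sum)
open import Data.List using () renaming (allFin to allFinL)
open import Data.Product using (_,_)
open import Relation.Binary.PropositionalEquality using (_≡_; refl)
open import Relation.Nullary.Decidable using (Dec; yes; no)

record SimpleGraph (n : ℕ) : Set where
  field
    adj    : Fin n → Fin n → Bool
    sym    : ∀ u v → adj u v ≡ adj v u
    irrefl : ∀ v → adj v v ≡ false

open SimpleGraph public

degree : ∀ {n} → SimpleGraph n → Fin n → ℕ
degree {n} G v = length (filter (λ u → isTrue (adj G v u)) (allFinL n))
  where
  isTrue : (b : Bool) → Dec (b ≡ true)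
  isTrue true  = yes refl
  isTrue false = no (λ ())

Findex : ∀ {n} → SimpleGraph n → ℕ
Findex {n} G = sum (map (λ v → degree G v ^ 3) (allFinL n))

-- Vertices: triangle x y z; i leaves at x; j leaves at y;
-- k pendant vertices at z; l leaves attached to the pendant vertex
-- pz 0 (the designated one among the k pendant vertices of z).
data RV (i j k l : ℕ) : Set where
  vx vy vz : RV i j k l
  lx : Fin i → RV i j k l
  ly : Fin j → RV i j k l
  pz : Fin k → RV i j k l
  lw : Fin l → RV i j k l

designated : ∀ {k} → Fin k → Bool
designated p = toℕ p ≡ᵇ 0

edgeR : ∀ {i j k l} → RV i j k l → RV i j k l → Bool
edgeR vx vy = true
edgeR vy vz = true
edgeR vx vz = true
edgeR vx (lx _) = true
edgeR vy (ly _) = true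
edgeR vz (pz _) = true
edgeR (pz p) (lw _) = designated p
edgeR _ _ = false

adjR : ∀ {i j k l} → RV i j k l → RV i j k l → Bool
adjR u v = edgeR u v ∨ edgeR v u

decodeR : ∀ i j k l → Fin (3 + (i + (j + (k + l)))) → RV i j k l
decodeR i j k l a with splitAt 3 a
... | inj₁ Fin.zero = vx
... | inj₁ (Fin.suc Fin.zero) = vy
... | inj₁ (Fin.suc (Fin.suc Fin.zero)) = vz
... | inj₂ b with splitAt i b
...   | inj₁ c = lx c
...   | inj₂ c with splitAt j c
...     | inj₁ d = ly d
...     | inj₂ d with splitAt k d
...       | inj₁ e = pz e
...       | inj₂ e = lw e

edgeR-irrefl : ∀ {i j k l} (v : RV i j k l) → edgeR v v ≡ false
edgeR-irrefl vx = refl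
edgeR-irrefl vy = refl
edgeR-irrefl vz = refl
edgeR-irrefl (lx _) = refl
edgeR-irrefl (ly _) = refl
edgeR-irrefl (pz _) = refl
edgeR-irrefl (lw _) = refl

-- R_{i,j,k,l} (meaningful for k ≥ 1), with i+j+k+l+3 vertices
R : (i j k l : ℕ) → SimpleGraph (3 + (i + (j + (k + l))))
R i j k l = record
  { adj    = λ a b → adjR (decodeR i j k l a) (decodeR i j k l b)
  ; sym    = λ a b → ∨-comm (edgeR (decodeR i j k l a) (decodeR i j k l b)) _
  ; irrefl = λ a → irr (decodeR i j k l a)
  }
  where
  irr : (v : RV i j k l) → adjR v v ≡ false
  irr v rewrite edgeR-irrefl v = refl

-- In R_{i,j,k,l} (k ≥ 1) the triangle vertices have degrees i + 2, j + 2, k + 2, the pendant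
-- vertex carrying the l leaves has degree l + 1, and all other vertices are leaves.  So for a
-- fixed number i + j of leaves at x and y, F depends on i and j only through (i+2)³ + (j+2)³.
-- Since the increments (n+1)³ − n³ grow with n, moving a leaf from the smaller of x, y to the
-- larger increases this sum, and so does moving all leaves of y to x.
module Submission where

open import Defs
open import Data.Nat using (ℕ; suc; _+_; _∸_; _≤_; _>_)
open import Data.Product using (_×_)
open import Relation.Binary.PropositionalEquality using (_≡_)

open import Data.Bool using (Bool; true; false; if_then_else_)
open import Data.Bool.Properties using (¬-not)
open import Data.Fin using (Fin; zero; suc; splitAt)
open import Data.List using ([]; _∷_; map; filter; length; tabulate; allFin)
import Data.Nat.ListAction as List
open import Data.Nat using (zero; _<_; _^_; _*_; s≤s)
open import Data.Nat.Properties
  using (+-0-commutativeMonoid; +-assoc; +-suc; +-identityʳ; +-monoˡ-<; m≤m+n; m≤n⇒∃[o]m+o≡n;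
         module ≤-Reasoning)
open import Algebra.Properties.CommutativeMonoid.Sum +-0-commutativeMonoid
  using (sum-syntax; sum-cong-≗)
  renaming (sum-replicate-zero to ∑-zeros)
open import Data.Nat.Solver using (module +-*-Solver)
open +-*-Solver using (solve; _:=_; _:+_; _:*_; _:^_; con)
open import Data.Nat.Tactic.RingSolver using (solve-∀)
open import Data.Product using (_,_)
open import Data.Sum using (_⊎_; inj₁; inj₂; [_,_]′)
import Data.Sum as Sum
open import Function using (_∘_; id)
open import Relation.Binary.PropositionalEquality
  using (refl; trans; cong; cong₂; _≗_; module ≡-Reasoning)
import Relation.Binary.PropositionalEquality as ≡
open import Relation.Nullary using (Dec; yes; no)

boolToℕ : Bool → ℕ
boolToℕ true  = 1
boolToℕ false = 0

∑-ones : ∀ n → ∑[ a < n ] 1 ≡ n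
∑-ones zero    = refl
∑-ones (suc n) = cong suc (∑-ones n)

∑-splitAt : ∀ m {n} (h : Fin m ⊎ Fin n → ℕ) →
  ∑[ a < m + n ] h (splitAt m a) ≡ ∑[ a < m ] h (inj₁ a) + ∑[ b < n ] h (inj₂ b)
∑-splitAt zero    h = refl
∑-splitAt (suc m) h =
  trans (cong (h (inj₁ zero) +_) (∑-splitAt m (h ∘ Sum.map₁ suc)))
        (≡.sym (+-assoc (h (inj₁ zero)) _ _))

length-filter≡sum : ∀ {A : Set} (f : A → Bool) (P? : ∀ x → Dec (f x ≡ true)) xs →
  length (filter P? xs) ≡ List.sum (map (boolToℕ ∘ f) xs)
length-filter≡sum f P? []       = refl
length-filter≡sum f P? (x ∷ xs) with P? x
... | yes fx≡true = cong₂ _+_ (cong boolToℕ (≡.sym fx≡true)) (length-filter≡sum f P? xs)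
... | no  fx≢true = trans (length-filter≡sum f P? xs)
                          (cong (λ b → boolToℕ b + List.sum (map (boolToℕ ∘ f) xs))
                                (≡.sym (¬-not fx≢true)))

sum-map-tabulate : ∀ {A : Set} n (f : Fin n → A) (g : A → ℕ) →
  List.sum (map g (tabulate f)) ≡ ∑[ a < n ] g (f a)
sum-map-tabulate zero    f g = refl
sum-map-tabulate (suc n) f g = cong (g (f zero) +_) (sum-map-tabulate n (f ∘ suc) g)

degree≡∑adj : ∀ {n} (G : SimpleGraph n) v → degree G v ≡ ∑[ u < n ] boolToℕ (adj G v u)
degree≡∑adj {n} G v =
  trans (length-filter≡sum (adj G v) _ (allFin n)) (sum-map-tabulate n id _)

Findex≡∑degree³ : ∀ {n} (G : SimpleGraph n) → Findex G ≡ ∑[ v < n ] (degree G v ^ 3)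
Findex≡∑degree³ {n} G = sum-map-tabulate n id _

module _ {i j k l : ℕ} where

  triangle : Fin 3 → RV i j k l
  triangle zero             = vx
  triangle (suc zero)       = vy
  triangle (suc (suc zero)) = vz

  private
    fromK : Fin k ⊎ Fin l → RV i j k l
    fromK = [ pz , lw ]′
    fromJ : Fin j ⊎ Fin (k + l) → RV i j k l
    fromJ = [ ly , fromK ∘ splitAt k ]′
    fromI : Fin i ⊎ Fin (j + (k + l)) → RV i j k l
    fromI = [ lx , fromJ ∘ splitAt j ]′
    from3 : Fin 3 ⊎ Fin (i + (j + (k + l))) → RV i j k l
    from3 = [ triangle , fromI ∘ splitAt i ]′

  decodeR≗from3∘splitAt : decodeR i j k l ≗ from3 ∘ splitAt 3
  decodeR≗from3∘splitAt a with splitAt 3 a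
  ... | inj₁ zero             = refl
  ... | inj₁ (suc zero)       = refl
  ... | inj₁ (suc (suc zero)) = refl
  ... | inj₂ b with splitAt i b
  ...   | inj₁ c = refl
  ...   | inj₂ c with splitAt j c
  ...     | inj₁ d = refl
  ...     | inj₂ d with splitAt k d
  ...       | inj₁ e = refl
  ...       | inj₂ e = refl

  ∑RV : (RV i j k l → ℕ) → ℕ
  ∑RV h = ∑[ t < 3 ] h (triangle t)
        + (∑[ a < i ] h (lx a) + (∑[ a < j ] h (ly a) + (∑[ a < k ] h (pz a) + ∑[ a < l ] h (lw a))))

  ∑RV-≡ : ∀ h {t a b c d} →
    ∑[ t < 3 ] h (triangle t) ≡ t → ∑[ a < i ] h (lx a) ≡ a → ∑[ a < j ] h (ly a) ≡ b →
    ∑[ a < k ] h (pz a) ≡ c → ∑[ a < l ] h (lw a) ≡ d →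
    ∑RV h ≡ t + (a + (b + (c + d)))
  ∑RV-≡ h refl refl refl refl refl = refl

  ∑-decodeR : ∀ h → ∑[ a < 3 + (i + (j + (k + l))) ] h (decodeR i j k l a) ≡ ∑RV h
  ∑-decodeR h =
    trans (sum-cong-≗ (cong h ∘ decodeR≗from3∘splitAt))
   (trans (∑-splitAt 3 (h ∘ from3))
   (cong (∑[ t < 3 ] h (triangle t) +_) (trans (∑-splitAt i (h ∘ fromI))
   (cong (∑[ a < i ] h (lx a) +_) (trans (∑-splitAt j (h ∘ fromJ))
   (cong (∑[ a < j ] h (ly a) +_) (∑-splitAt k (h ∘ fromK))))))))

  degR : RV i j k l → ℕ
  degR vx     = 2 + i
  degR vy     = 2 + j
  degR vz     = 2 + k
  degR (lx _) = 1
  degR (ly _) = 1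
  degR (pz p) = if designated p then 1 + l else 1
  degR (lw _) = 1

-- For k = 0 there is no vertex pz 0, the leaves lw are isolated and degR is wrong for them.
module _ (i j k′ l : ℕ) where

  ∑RV-adjR≡degR : (v : RV i j (suc k′) l) → ∑RV (boolToℕ ∘ adjR v) ≡ degR v
  ∑RV-adjR≡degR v@vx =
    trans (∑RV-≡ (boolToℕ ∘ adjR v) refl (∑-ones i) (∑-zeros j) (∑-zeros (suc k′)) (∑-zeros l))
          (cong (2 +_) (+-identityʳ i))
  ∑RV-adjR≡degR v@vy =
    trans (∑RV-≡ (boolToℕ ∘ adjR v) refl (∑-zeros i) (∑-ones j) (∑-zeros (suc k′)) (∑-zeros l))
          (cong (2 +_) (+-identityʳ j))
  ∑RV-adjR≡degR v@vz =
    trans (∑RV-≡ (boolToℕ ∘ adjR v) refl (∑-zeros i) (∑-zeros j) (∑-ones (suc k′)) (∑-zeros l))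
          (cong (2 +_) (+-identityʳ (suc k′)))
  ∑RV-adjR≡degR v@(lx _) =
    ∑RV-≡ (boolToℕ ∘ adjR v) refl (∑-zeros i) (∑-zeros j) (∑-zeros (suc k′)) (∑-zeros l)
  ∑RV-adjR≡degR v@(ly _) =
    ∑RV-≡ (boolToℕ ∘ adjR v) refl (∑-zeros i) (∑-zeros j) (∑-zeros (suc k′)) (∑-zeros l)
  ∑RV-adjR≡degR v@(pz zero) =
    ∑RV-≡ (boolToℕ ∘ adjR v) refl (∑-zeros i) (∑-zeros j) (∑-zeros (suc k′)) (∑-ones l)
  ∑RV-adjR≡degR v@(pz (suc _)) =
    ∑RV-≡ (boolToℕ ∘ adjR v) refl (∑-zeros i) (∑-zeros j) (∑-zeros (suc k′)) (∑-zeros l)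
  ∑RV-adjR≡degR v@(lw _) =
    ∑RV-≡ (boolToℕ ∘ adjR v) refl (∑-zeros i) (∑-zeros j) (cong suc (∑-zeros k′)) (∑-zeros l)

  degree-R : ∀ a → degree (R i j (suc k′) l) a ≡ degR (decodeR i j (suc k′) l a)
  degree-R a = trans (degree≡∑adj (R i j (suc k′) l) a)
                     (trans (∑-decodeR (boolToℕ ∘ adjR v)) (∑RV-adjR≡degR v))
    where v = decodeR i j (suc k′) l a

  Findex-R : Findex (R i j (suc k′) l)
           ≡ (2 + i) ^ 3 + (2 + j) ^ 3 + ((3 + k′) ^ 3 + (1 + l) ^ 3 + (i + j + (k′ + l)))
  Findex-R = begin
    Findex (R i j (suc k′) l)
      ≡⟨ Findex≡∑degree³ (R i j (suc k′) l) ⟩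
    ∑[ a < 3 + (i + (j + (suc k′ + l))) ] (degree (R i j (suc k′) l) a ^ 3)
      ≡⟨ sum-cong-≗ (cong (_^ 3) ∘ degree-R) ⟩
    ∑[ a < 3 + (i + (j + (suc k′ + l))) ] degR³ (decodeR i j (suc k′) l a)
      ≡⟨ ∑-decodeR degR³ ⟩
    ∑RV degR³
      ≡⟨ ∑RV-≡ degR³ refl (∑-ones i) (∑-ones j) (cong ((1 + l) ^ 3 +_) (∑-ones k′)) (∑-ones l) ⟩
    (2 + i) ^ 3 + ((2 + j) ^ 3 + ((3 + k′) ^ 3 + 0)) + (i + (j + ((1 + l) ^ 3 + k′ + l)))
      ≡⟨ regroup ((2 + i) ^ 3) ((2 + j) ^ 3) ((3 + k′) ^ 3) ((1 + l) ^ 3) i j k′ l ⟩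
    (2 + i) ^ 3 + (2 + j) ^ 3 + ((3 + k′) ^ 3 + (1 + l) ^ 3 + (i + j + (k′ + l))) ∎
    where
    open ≡-Reasoning
    degR³ : RV i j (suc k′) l → ℕ
    degR³ v = degR v ^ 3
    regroup : ∀ x y z w i j k l →
      x + (y + (z + 0)) + (i + (j + (w + k + l))) ≡ x + y + (z + w + (i + j + (k + l)))
    regroup = solve-∀

Findex-R-< : ∀ {k′ l} i j i′ j′ → i + j ≡ i′ + j′ →
  (2 + i) ^ 3 + (2 + j) ^ 3 < (2 + i′) ^ 3 + (2 + j′) ^ 3 →
  Findex (R i j (suc k′) l) < Findex (R i′ j′ (suc k′) l)
Findex-R-< {k′} {l} i j i′ j′ leaves cubes = begin-strict
  Findex (R i j (suc k′) l)                     ≡⟨ Findex-R i j k′ l ⟩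
  (2 + i) ^ 3 + (2 + j) ^ 3 + rest (i + j)      <⟨ +-monoˡ-< (rest (i + j)) cubes ⟩
  (2 + i′) ^ 3 + (2 + j′) ^ 3 + rest (i + j)    ≡⟨ cong (λ s → (2 + i′) ^ 3 + (2 + j′) ^ 3 + rest s) leaves ⟩
  (2 + i′) ^ 3 + (2 + j′) ^ 3 + rest (i′ + j′)  ≡⟨ Findex-R i′ j′ k′ l ⟨
  Findex (R i′ j′ (suc k′) l)                   ∎
  where
  open ≤-Reasoning
  rest : ℕ → ℕ
  rest s = (3 + k′) ^ 3 + (1 + l) ^ 3 + (s + (k′ + l))

<-of-≡suc+ : ∀ {m n} d → n ≡ suc (m + d) → m < n
<-of-≡suc+ {m} d refl = s≤s (m≤m+n m d)

-- The excess of the right side is 3 (n − m) (n + m + 1).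
cube-smoothing : ∀ {m n} → m < n → n ^ 3 + suc m ^ 3 < suc n ^ 3 + m ^ 3
cube-smoothing {m} {suc n} (s≤s m≤n) with m≤n⇒∃[o]m+o≡n m≤n
... | d , refl = <-of-≡suc+ (6 * m + 9 * d + 6 * m * d + 3 * d * d + 5)
  (solve 2 (λ m d → (con 2 :+ m :+ d) :^ 3 :+ m :^ 3
                 := con 1 :+ ((con 1 :+ (m :+ d)) :^ 3 :+ (con 1 :+ m) :^ 3
                              :+ (con 6 :* m :+ con 9 :* d :+ con 6 :* m :* d
                                  :+ con 3 :* d :* d :+ con 5)))
         refl m d)

cube-merge : ∀ x y → (3 + x) ^ 3 + (3 + y) ^ 3 < (2 + (suc x + suc y)) ^ 3 + 2 ^ 3
cube-merge x y = <-of-≡suc+ excess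
  (solve 2 (λ x y → (con 2 :+ ((con 1 :+ x) :+ (con 1 :+ y))) :^ 3 :+ con 8
                 := con 1 :+ ((con 3 :+ x) :^ 3 :+ (con 3 :+ y) :^ 3
                              :+ (con 17 :+ con 21 :* x :+ con 21 :* y :+ con 3 :* x :* x
                                  :+ con 3 :* y :* y :+ con 24 :* x :* y
                                  :+ con 3 :* x :* x :* y :+ con 3 :* x :* y :* y)))
         refl x y)
  where
  excess : ℕ
  excess = 17 + 21 * x + 21 * y + 3 * x * x + 3 * y * y + 24 * x * y
         + 3 * x * x * y + 3 * x * y * y

theorem6 : (n i j k l : ℕ) → j ≤ i → 1 ≤ j → 1 ≤ k → 1 ≤ l →
    i + j + k + l ≡ n ∸ 3 →
    (Findex (R (suc i) (j ∸ 1) k l) > Findex (R i j k l))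
      × (Findex (R (i + j) 0 k l) > Findex (R i j k l))
theorem6 _ _       zero    _        _ _          ()
theorem6 _ _       (suc _) zero     _ _          _ ()
theorem6 _ (suc i) (suc j) (suc k′) l (s≤s j≤i) _ _ _ _ =
  Findex-R-< (suc i) (suc j) (suc (suc i)) j (+-suc (suc i) j)
             (cube-smoothing (s≤s (s≤s (s≤s j≤i)))) ,
  Findex-R-< (suc i) (suc j) (suc i + suc j) 0 (≡.sym (+-identityʳ (suc i + suc j)))
             (cube-merge i j)
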